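{- Let $n$ be a positive integer. All downsets $\mathcal{F}$ with $|U(\mathcal{F})|\le n$ have the star property if and only if the integer program $I_n$ is infeasible.
   Context: Let $[n]=\{1,\dots,n\}$ and $2^{[n]}$ its power set. A family is a set of subsets of a finite ground set; $U(\mathcal{F})$ is the union of all sets in $\mathcal{F}$. A family $\mathcal{D}$ is a downset if $A\in\mathcal{D}$, $B\subseteq A$ imply $B\in\mathcal{D}$. A family is intersecting if any two of its sets have nonempty intersection; it is a star if some element of $U(\mathcal{F})$ lies in all its sets; $\mathcal{F}$ has the star property if some maximum-cardinality intersecting family contained in $\mathcal{F}$ is a star. The integer program $I_n$ has binary variables $x_S, y_S\in\{0,1\}$ for all $S\in 2^{[n]}$, objective $\max \sum_{S\in 2^{[n]}} x_S$, and constraints: (i) $x_T\le x_S$ for all $S,T\in 2^{[n]}$ with $S\subsetneq T$; (ii) $y_T+y_S\le 1$ for all nonempty $S,T\in 2^{[n]}$ with $S\cap T=\emptyset$; (iii) $y_S\le x_S$ for all $S\in 2^{[n]}$; (iv) $\sum_{S\in 2^{[n]}: i\in S} x_S + 1 \le \sum_{S\in 2^{[n]}\setminus\{\emptyset\}} y_S$ for all $i\in[n]$. -}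

module Defs where

open import Data.Bool.Base using (Bool; true; false; if_then_else_)
open import Data.Nat.Base using (ℕ; zero; suc; _+_; _≤_)
open import Data.Fin.Base using (Fin)
open import Data.Vec.Base using ([]; _∷_)
open import Data.List.Base using (List; []; _∷_; _++_; map; filterᵇ)
open import Data.Nat.ListAction using (sum)
open import Data.Fin.Subset using (Subset; _∈_; _⊆_; _∩_; Nonempty; ⋃; ∣_∣)
  renaming (⊥ to ∅)
open import Data.Fin.Subset.Properties using (_∈?_; nonempty?)
open import Data.Product.Base using (Σ; ∃; _×_)
open import Data.Sum.Base using (_⊎_)
open import Relation.Nullary using (¬_; does)
open import Relation.Binary.PropositionalEquality using (_≡_; _≢_)

allSubsets : (m : ℕ) → List (Subset m)
allSubsets zero    = [] ∷ []
allSubsets (suc m) = map (false ∷_) (allSubsets m) ++ map (true ∷_) (allSubsets m)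

⟦_⟧ : Bool → ℕ
⟦ true  ⟧ = 1
⟦ false ⟧ = 0

ΣS : {m : ℕ} → (Subset m → ℕ) → ℕ
ΣS {m} f = sum (map f (allSubsets m))

Family : ℕ → Set
Family m = Subset m → Bool

_∈F_ : {m : ℕ} → Subset m → Family m → Set
S ∈F F = F S ≡ true

card : {m : ℕ} → Family m → ℕ
card F = ΣS (λ S → ⟦ F S ⟧)

members : {m : ℕ} → Family m → List (Subset m)
members {m} F = filterᵇ F (allSubsets m)

U : {m : ℕ} → Family m → Subset m
U F = ⋃ (members F)

_⊆F_ : {m : ℕ} → Family m → Family m → Set
G ⊆F F = ∀ S → S ∈F G → S ∈F F

Downset : {m : ℕ} → Family m → Set
Downset F = ∀ A B → A ∈F F → B ⊆ A → B ∈F F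

-- intersecting: any two sets (not necessarily distinct) meet
Intersecting : {m : ℕ} → Family m → Set
Intersecting F = ∀ S T → S ∈F F → T ∈F F → Nonempty (S ∩ T)

-- star: some element of U(F) lies in all sets of F.
-- Convention: the empty family is counted as a star.
NoMembers : {m : ℕ} → Family m → Set
NoMembers F = ∀ S → ¬ (S ∈F F)

Star : {m : ℕ} → Family m → Set
Star {m} F = NoMembers F ⊎ (Σ (Fin m) λ i → i ∈ U F × (∀ S → S ∈F F → i ∈ S))

MaxIntersectingIn : {m : ℕ} → Family m → Family m → Set
MaxIntersectingIn F G =
  G ⊆F F × Intersecting G × (∀ H → H ⊆F F → Intersecting H → card H ≤ card G)

StarProperty : {m : ℕ} → Family m → Set
StarProperty F = ∃ λ G → MaxIntersectingIn F G × Star G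

AllDownsetsStar : ℕ → Set
AllDownsetsStar n =
  (m : ℕ) (F : Family m) → Downset F → ∣ U F ∣ ≤ n → StarProperty F

Constraints : (n : ℕ) → (x y : Subset n → Bool) → Set
Constraints n x y =
    (∀ S T → S ⊆ T → S ≢ T → ⟦ x T ⟧ ≤ ⟦ x S ⟧)
  × (∀ S T → Nonempty S → Nonempty T → S ∩ T ≡ ∅ → ⟦ y T ⟧ + ⟦ y S ⟧ ≤ 1)
  × (∀ S → ⟦ y S ⟧ ≤ ⟦ x S ⟧)
  × (∀ (i : Fin n) →
       ΣS (λ S → if does (i ∈? S) then ⟦ x S ⟧ else 0) + 1
         ≤ ΣS (λ S → if does (nonempty? S) then ⟦ y S ⟧ else 0))

-- I_n is feasible iff some binary assignment satisfies all constraints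
-- (the objective plays no role in feasibility).
Feasible : ℕ → Set
Feasible n = ∃ λ (x : Subset n → Bool) → ∃ λ (y : Subset n → Bool) → Constraints n x y

Infeasible : ℕ → Set
Infeasible n = ¬ Feasible n

-- A feasible point (x, y) of I_n is a downset x whose nonempty y-sets form an
-- intersecting subfamily which, by (iv), is larger than every star
-- {S ∈ x : i ∈ S}; so no maximum intersecting subfamily of x is a star.
-- Conversely, if a downset F lacks the star property, a maximum intersecting
-- G ⊆ F beats every star of F, and (F, G) is feasible for I_m on the ground
-- set of F; deleting coordinates outside U(F) and adding unused ones turns it
-- into a feasible point of I_n.

module Submission where

open import Defs
open import Data.Nat.Base using (ℕ; _≤_)
open import Function.Bundles using (_⇔_; mk⇔; module Equivalence)

open import Data.Bool.Base using (Bool; true; false; if_then_else_)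
open import Data.Bool.Properties using (¬-not) renaming (_≟_ to _≟ᵇ_)
open import Data.Nat.Base using (zero; suc; _+_; _∸_; _<_; z≤n; s≤s)
open import Data.Nat.Properties
  using (≤-refl; ≤-trans; ≤-reflexive; +-mono-≤; +-monoˡ-≤; +-comm; m≤m+n; m≤n+m; +-suc; +-identityʳ;
         m∸n+n≡m; _≤?_; ≰⇒>; +-commutativeSemigroup; m+1+n≰m; <-≤-trans; module ≤-Reasoning)
open import Data.Fin.Base as Fin using (Fin; punchIn; punchOut)
open import Data.Fin.Properties using (any?; _≟_; punchIn-punchOut)
open import Data.Vec.Base using ([]; _∷_; here; there; tail; insertAt; removeAt)
open import Data.Vec.Properties
  using (insertAt-lookup; insertAt-punchIn; removeAt-insertAt; []=⇒lookup; lookup⇒[]=; ≡-dec)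
open import Data.List.Base using (List; []; _∷_; map; _++_; filter; filterᵇ; cartesianProductWith)
open import Data.List.Properties using (map-cong; map-++; map-∘)
open import Data.Nat.ListAction using (sum)
open import Data.Nat.ListAction.Properties using (sum-++)
open import Data.List.Membership.Propositional using () renaming (_∈_ to _∈ᴸ_)
open import Data.List.Membership.Propositional.Properties
  using (∈-map⁺; ∈-++⁺ˡ; ∈-++⁺ʳ; ∈-filter⁺; ∈-cartesianProductWith⁺)
open import Data.List.Relation.Unary.Any using () renaming (here to hereᴸ; there to thereᴸ)
open import Data.List.Relation.Unary.All using (lookup)
open import Data.List.Relation.Unary.All.Properties using (all-filter)
open import Algebra.Properties.CommutativeSemigroup +-commutativeSemigroup using (interchange)
open import Data.List.Extrema.Nat using (argmax; argmax-all; f[xs]≤f[argmax])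
open import Data.Fin.Subset using (Subset; _∈_; _∉_; _⊆_; _∩_; Nonempty; ⋃; ∣_∣) renaming (⊥ to ∅)
open import Data.Fin.Subset.Properties
  using (_∈?_; nonempty?; anySubset?; ∣p∣≤n; p⊆q⇒∣p∣≤∣q∣; Empty-unique; ∉⊥; drop-∷-⊆;
         x∈p∩q⁺; x∈p∩q⁻; x∈p∪q⁺; x∈p∪q⁻)
open import Data.Product.Base using (∃; _×_; _,_; proj₁; proj₂)
open import Data.Sum.Base using (inj₁; inj₂)
open import Data.Empty using (⊥; ⊥-elim)
open import Relation.Nullary using (¬_; Dec; yes; no; does; contradiction)
open import Relation.Nullary.Decidable using (does-⇔; decidable-stable; ¬?; _×-dec_; _→-dec_; map′)
open import Relation.Unary using (Decidable)
open import Function.Base using (_∘_)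
open import Relation.Binary.PropositionalEquality
  using (_≡_; _≢_; refl; sym; trans; cong; cong₂; subst; subst₂; module ≡-Reasoning)

private
  variable
    m n : ℕ
    A : Set

ΣS-suc : (f : Subset (suc m) → ℕ) → ΣS f ≡ ΣS (λ S → f (false ∷ S)) + ΣS (λ S → f (true ∷ S))
ΣS-suc {m} f = begin
  sum (map f (map (false ∷_) Ss ++ map (true ∷_) Ss))
    ≡⟨ cong sum (map-++ f (map (false ∷_) Ss) (map (true ∷_) Ss)) ⟩
  sum (map f (map (false ∷_) Ss) ++ map f (map (true ∷_) Ss))
    ≡⟨ sum-++ (map f (map (false ∷_) Ss)) _ ⟩
  sum (map f (map (false ∷_) Ss)) + sum (map f (map (true ∷_) Ss))
    ≡⟨ cong₂ _+_ (cong sum (map-∘ Ss)) (cong sum (map-∘ Ss)) ⟨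
  ΣS (λ S → f (false ∷ S)) + ΣS (λ S → f (true ∷ S)) ∎
  where
  open ≡-Reasoning
  Ss = allSubsets m

ΣS-cong : {f g : Subset m → ℕ} → (∀ S → f S ≡ g S) → ΣS f ≡ ΣS g
ΣS-cong {m} f≗g = cong sum (map-cong f≗g (allSubsets m))

ΣS-mono : {f g : Subset m → ℕ} → (∀ S → f S ≤ g S) → ΣS f ≤ ΣS g
ΣS-mono {zero} f≤g = +-monoˡ-≤ 0 (f≤g [])
ΣS-mono {suc m} {f} {g} f≤g rewrite ΣS-suc f | ΣS-suc g =
  +-mono-≤ (ΣS-mono (λ S → f≤g (false ∷ S))) (ΣS-mono (λ S → f≤g (true ∷ S)))

ΣS-zero : {f : Subset m → ℕ} → (∀ S → f S ≡ 0) → ΣS f ≡ 0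
ΣS-zero {zero} f≡0 = cong (_+ 0) (f≡0 [])
ΣS-zero {suc m} {f} f≡0 rewrite ΣS-suc f =
  cong₂ _+_ (ΣS-zero (λ S → f≡0 (false ∷ S))) (ΣS-zero (λ S → f≡0 (true ∷ S)))

f≤ΣS : (f : Subset m → ℕ) (S : Subset m) → f S ≤ ΣS f
f≤ΣS {zero} f [] = m≤m+n (f []) 0
f≤ΣS {suc m} f (false ∷ S) rewrite ΣS-suc f = ≤-trans (f≤ΣS _ S) (m≤m+n _ _)
f≤ΣS {suc m} f (true ∷ S) rewrite ΣS-suc f = ≤-trans (f≤ΣS _ S) (m≤n+m _ _)

ΣS-insertAt : (j : Fin (suc m)) (f : Subset (suc m) → ℕ) →
              ΣS f ≡ ΣS (λ S → f (insertAt S j false)) + ΣS (λ S → f (insertAt S j true))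
ΣS-insertAt Fin.zero f = ΣS-suc f
ΣS-insertAt {suc m} (Fin.suc j) f = begin
  ΣS f
    ≡⟨ ΣS-suc f ⟩
  ΣS (f ∘ (false ∷_)) + ΣS (f ∘ (true ∷_))
    ≡⟨ cong₂ _+_ (ΣS-insertAt j _) (ΣS-insertAt j _) ⟩
  (a + b) + (c + d)
    ≡⟨ interchange a b c d ⟩
  (a + c) + (b + d)
    ≡⟨ cong₂ _+_ (ΣS-suc (f ∘ insertAt′ false)) (ΣS-suc (f ∘ insertAt′ true)) ⟨
  ΣS (f ∘ insertAt′ false) + ΣS (f ∘ insertAt′ true) ∎
  where
  open ≡-Reasoning
  insertAt′ : Bool → Subset (suc m) → Subset (suc (suc m))
  insertAt′ b S = insertAt S (Fin.suc j) b
  a = ΣS (λ S → f (false ∷ insertAt S j false))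
  b = ΣS (λ S → f (false ∷ insertAt S j true))
  c = ΣS (λ S → f (true ∷ insertAt S j false))
  d = ΣS (λ S → f (true ∷ insertAt S j true))

allSubsets-complete : (S : Subset m) → S ∈ᴸ allSubsets m
allSubsets-complete [] = hereᴸ refl
allSubsets-complete {suc m} (false ∷ S) = ∈-++⁺ˡ (∈-map⁺ (false ∷_) (allSubsets-complete S))
allSubsets-complete {suc m} (true ∷ S) =
  ∈-++⁺ʳ (map (false ∷_) (allSubsets m)) (∈-map⁺ (true ∷_) (allSubsets-complete S))

module _ (F : Family m) where

  ∈⋃-filterᵇ⁺ : ∀ {Ss S i} → S ∈ᴸ Ss → S ∈F F → i ∈ S → i ∈ ⋃ (filterᵇ F Ss)
  ∈⋃-filterᵇ⁺ (hereᴸ refl) S∈F i∈S rewrite S∈F = x∈p∪q⁺ (inj₁ i∈S)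
  ∈⋃-filterᵇ⁺ {T ∷ _} (thereᴸ S∈Ss) S∈F i∈S with F T
  ... | true = x∈p∪q⁺ (inj₂ (∈⋃-filterᵇ⁺ S∈Ss S∈F i∈S))
  ... | false = ∈⋃-filterᵇ⁺ S∈Ss S∈F i∈S

  ∈⋃-filterᵇ⁻ : ∀ Ss {i} → i ∈ ⋃ (filterᵇ F Ss) → ∃ λ S → S ∈F F × i ∈ S
  ∈⋃-filterᵇ⁻ [] i∈ = contradiction i∈ ∉⊥
  ∈⋃-filterᵇ⁻ (T ∷ Ss) i∈ with F T in T∈F
  ... | false = ∈⋃-filterᵇ⁻ Ss i∈
  ... | true with x∈p∪q⁻ T _ i∈
  ...   | inj₁ i∈T = T , T∈F , i∈T
  ...   | inj₂ i∈⋃ = ∈⋃-filterᵇ⁻ Ss i∈⋃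

  ∈U⁺ : ∀ {S i} → S ∈F F → i ∈ S → i ∈ U F
  ∈U⁺ {S} = ∈⋃-filterᵇ⁺ (allSubsets-complete S)

  ∈U⁻ : ∀ {i} → i ∈ U F → ∃ λ S → S ∈F F × i ∈ S
  ∈U⁻ = ∈⋃-filterᵇ⁻ (allSubsets m)

module _ {j : Fin (suc m)} {b : Bool} {S : Subset m} where

  ∈-insertAt-punchIn⁺ : {i : Fin m} → i ∈ S → punchIn j i ∈ insertAt S j b
  ∈-insertAt-punchIn⁺ {i} i∈S = lookup⇒[]= _ _ (trans (insertAt-punchIn S j b i) ([]=⇒lookup i∈S))

  ∈-insertAt-punchIn⁻ : {i : Fin m} → punchIn j i ∈ insertAt S j b → i ∈ S
  ∈-insertAt-punchIn⁻ {i} p = lookup⇒[]= _ _ (trans (sym (insertAt-punchIn S j b i)) ([]=⇒lookup p))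

  ∈-insertAt-self : j ∈ insertAt S j b → b ≡ true
  ∈-insertAt-self p = trans (sym (insertAt-lookup S j b)) ([]=⇒lookup p)

∈-insertAt-true : (S : Subset m) (j : Fin (suc m)) → j ∈ insertAt S j true
∈-insertAt-true S j = lookup⇒[]= _ _ (insertAt-lookup S j true)

∈-insertAt-false⁻ : {j k : Fin (suc m)} {S : Subset m} →
                    k ∈ insertAt S j false → ∃ λ i → punchIn j i ≡ k × i ∈ S
∈-insertAt-false⁻ {j = j} {k} k∈ with j ≟ k
... | yes refl with () ← ∈-insertAt-self k∈
... | no j≢k = punchOut j≢k , punchIn-punchOut j≢k ,
  ∈-insertAt-punchIn⁻ (subst (_∈ insertAt _ j false) (sym (punchIn-punchOut j≢k)) k∈)

module _ {j : Fin (suc m)} where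

  insertAt-false-⊆ : {S T : Subset m} → S ⊆ T → insertAt S j false ⊆ insertAt T j false
  insertAt-false-⊆ S⊆T k∈ with ∈-insertAt-false⁻ k∈
  ... | i , refl , i∈S = ∈-insertAt-punchIn⁺ (S⊆T i∈S)

  insertAt-injective : {b : Bool} {S T : Subset m} → insertAt S j b ≡ insertAt T j b → S ≡ T
  insertAt-injective {b} {S} {T} eq = begin
    S                            ≡⟨ removeAt-insertAt S j b ⟨
    removeAt (insertAt S j b) j  ≡⟨ cong (λ V → removeAt V j) eq ⟩
    removeAt (insertAt T j b) j  ≡⟨ removeAt-insertAt T j b ⟩
    T                            ∎
    where open ≡-Reasoning

  insertAt-false-disjoint : (S T : Subset m) → S ∩ T ≡ ∅ → insertAt S j false ∩ insertAt T j false ≡ ∅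
  insertAt-false-disjoint S T S∩T≡∅ = Empty-unique λ (k , k∈) →
    let k∈S′ , k∈T′ = x∈p∩q⁻ (insertAt S j false) _ k∈
        i , i↦k , i∈S = ∈-insertAt-false⁻ k∈S′
        i∈T = ∈-insertAt-punchIn⁻ (subst (_∈ insertAt T j false) (sym i↦k) k∈T′)
    in ∉⊥ (subst (i ∈_) S∩T≡∅ (x∈p∩q⁺ (i∈S , i∈T)))

  Nonempty-insertAt-false : {S : Subset m} → Nonempty (insertAt S j false) ⇔ Nonempty S
  Nonempty-insertAt-false = mk⇔
    (λ (k , k∈) → let i , _ , i∈S = ∈-insertAt-false⁻ k∈ in i , i∈S)
    (λ (i , i∈S) → punchIn j i , ∈-insertAt-punchIn⁺ i∈S)

∣insertAt-false∣ : (S : Subset m) (j : Fin (suc m)) → ∣ insertAt S j false ∣ ≡ ∣ S ∣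
∣insertAt-false∣ S Fin.zero = refl
∣insertAt-false∣ (true ∷ S) (Fin.suc j) = cong suc (∣insertAt-false∣ S j)
∣insertAt-false∣ (false ∷ S) (Fin.suc j) = ∣insertAt-false∣ S j

⟦⟧-mono : {b c : Bool} → (b ≡ true → c ≡ true) → ⟦ b ⟧ ≤ ⟦ c ⟧
⟦⟧-mono {false} _ = z≤n
⟦⟧-mono {true} b⇒c rewrite b⇒c refl = ≤-refl

⟦⟧-mono⁻ : {b c : Bool} → ⟦ b ⟧ ≤ ⟦ c ⟧ → b ≡ true → c ≡ true
⟦⟧-mono⁻ {c = true} _ _ = refl
⟦⟧-mono⁻ {true} {false} () refl

⟦⟧+⟦⟧≤1 : {b c : Bool} → (b ≡ true → c ≡ true → ⊥) → ⟦ b ⟧ + ⟦ c ⟧ ≤ 1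
⟦⟧+⟦⟧≤1 {false} {false} _ = z≤n
⟦⟧+⟦⟧≤1 {false} {true} _ = ≤-refl
⟦⟧+⟦⟧≤1 {true} {false} _ = ≤-refl
⟦⟧+⟦⟧≤1 {true} {true} ¬both = ⊥-elim (¬both refl refl)

⟦⟧+⟦⟧≤1⁻ : {b c : Bool} → ⟦ b ⟧ + ⟦ c ⟧ ≤ 1 → b ≡ true → c ≡ true → ⊥
⟦⟧+⟦⟧≤1⁻ (s≤s ()) refl refl

-- degree x i and nonemptyCount y are, definitionally, the two sides of constraint (iv).
weight : (p x : Subset m → Bool) → ℕ
weight p x = ΣS (λ S → if p S then ⟦ x S ⟧ else 0)

degree : (Subset m → Bool) → Fin m → ℕ
degree x i = weight (λ S → does (i ∈? S)) x

nonemptyCount : (Subset m → Bool) → ℕ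
nonemptyCount = weight (λ S → does (nonempty? S))

weight-cong : {p q x : Subset m → Bool} → (∀ S → p S ≡ q S) → weight p x ≡ weight q x
weight-cong {x = x} p≗q = ΣS-cong λ S → cong (λ d → if d then ⟦ x S ⟧ else 0) (p≗q S)

card-cong : {F G : Family m} → (∀ S → F S ≡ G S) → card F ≡ card G
card-cong F≗G = ΣS-cong λ S → cong ⟦_⟧ (F≗G S)

card-mono : {F G : Family m} → F ⊆F G → card F ≤ card G
card-mono F⊆G = ΣS-mono λ S → ⟦⟧-mono (F⊆G S)

card-NoMembers : {F : Family m} → NoMembers F → card F ≡ 0
card-NoMembers none = ΣS-zero λ S → cong ⟦_⟧ (¬-not (none S))

card-pos : {F : Family m} {S : Subset m} → S ∈F F → 1 ≤ card F
card-pos {F = F} {S} S∈F = subst (λ b → ⟦ b ⟧ ≤ card F) S∈F (f≤ΣS (λ S → ⟦ F S ⟧) S)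

module _ {P : Subset m → Set} (P? : Decidable P) where

  restrict : Family m → Family m
  restrict F S = if does (P? S) then F S else false

  restrict⁺ : ∀ F {S} → P S → S ∈F F → S ∈F restrict F
  restrict⁺ F {S} PS S∈F with P? S
  ... | yes _ = S∈F
  ... | no ¬PS = contradiction PS ¬PS

  restrict⁻ : ∀ F {S} → S ∈F restrict F → P S × S ∈F F
  restrict⁻ F {S} S∈ with P? S
  ... | yes PS = PS , S∈

  card-restrict : (F : Family m) → card (restrict F) ≡ weight (does ∘ P?) F
  card-restrict F = ΣS-cong λ S → ⟦if⟧ (does (P? S))
    where
    ⟦if⟧ : ∀ {b} d → ⟦ (if d then b else false) ⟧ ≡ (if d then ⟦ b ⟧ else 0)
    ⟦if⟧ true = refl
    ⟦if⟧ false = refl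

  restrict-all : ∀ F → (∀ S → S ∈F F → P S) → ∀ S → restrict F S ≡ F S
  restrict-all F all-P S with P? S | F S in S∈F
  ... | yes _ | _ = refl
  ... | no _ | false = refl
  ... | no ¬PS | true = contradiction (all-P S S∈F) ¬PS

-- Changing the ground set of a feasible point

avoiding : Fin (suc m) → (Subset (suc m) → A) → Subset m → A
avoiding j x S = x (insertAt S j false)

Avoids : (Subset (suc m) → Bool) → Fin (suc m) → Set
Avoids x j = ∀ S → j ∈ S → x S ≡ false

∉U⇒Avoids : {x : Subset (suc m) → Bool} {j : Fin (suc m)} → j ∉ U x → Avoids x j
∉U⇒Avoids {x = x} j∉U S j∈S = ¬-not λ S∈x → j∉U (∈U⁺ x S∈x j∈S)

Avoids-≤ : {x y : Subset (suc m) → Bool} {j : Fin (suc m)} →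
           (∀ S → ⟦ y S ⟧ ≤ ⟦ x S ⟧) → Avoids x j → Avoids y j
Avoids-≤ y≤x x-avoids S j∈S =
  ¬-not λ S∈y → contradiction (trans (sym (⟦⟧-mono⁻ (y≤x S) S∈y)) (x-avoids S j∈S)) λ ()

module _ {x : Subset (suc m) → Bool} {j : Fin (suc m)} (x-avoids : Avoids x j) where

  weight-avoiding : (p : Subset (suc m) → Bool) → weight (avoiding j p) (avoiding j x) ≡ weight p x
  weight-avoiding p = begin
    weight (avoiding j p) (avoiding j x)
      ≡⟨ +-identityʳ _ ⟨
    ΣS (avoiding j term) + 0
      ≡⟨ cong (ΣS (avoiding j term) +_) (ΣS-zero vanishes) ⟨
    ΣS (avoiding j term) + ΣS (λ S → term (insertAt S j true))
      ≡⟨ ΣS-insertAt j term ⟨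
    weight p x ∎
    where
    open ≡-Reasoning
    term : Subset (suc m) → ℕ
    term S = if p S then ⟦ x S ⟧ else 0
    vanishes : ∀ S → term (insertAt S j true) ≡ 0
    vanishes S with p (insertAt S j true)
    ... | true = cong ⟦_⟧ (x-avoids _ (∈-insertAt-true S j))
    ... | false = refl

  degree-avoiding : (i : Fin m) → degree (avoiding j x) i ≡ degree x (punchIn j i)
  degree-avoiding i = trans
    (weight-cong {x = avoiding j x} λ S →
      does-⇔ (mk⇔ (∈-insertAt-punchIn⁺ {j = j} {false}) ∈-insertAt-punchIn⁻)
             (i ∈? S) (punchIn j i ∈? insertAt S j false))
    (weight-avoiding (λ S → does (punchIn j i ∈? S)))

  nonemptyCount-avoiding : nonemptyCount (avoiding j x) ≡ nonemptyCount x
  nonemptyCount-avoiding = trans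
    (weight-cong {x = avoiding j x} λ S →
      sym (does-⇔ (Nonempty-insertAt-false {j = j}) (nonempty? (insertAt S j false)) (nonempty? S)))
    (weight-avoiding (λ S → does (nonempty? S)))

Constraints-avoiding : {x y : Subset (suc m) → Bool} {j : Fin (suc m)} → Avoids x j →
  Constraints (suc m) x y → Constraints m (avoiding j x) (avoiding j y)
Constraints-avoiding {j = j} x-avoids (mono , disjoint , y≤x , degree<) =
  (λ S T S⊆T S≢T → mono _ _ (insertAt-false-⊆ S⊆T) (S≢T ∘ insertAt-injective)) ,
  (λ S T S≠∅ T≠∅ S∩T≡∅ →
    disjoint _ _ (nonempty⁺ S≠∅) (nonempty⁺ T≠∅) (insertAt-false-disjoint S T S∩T≡∅)) ,
  (λ S → y≤x _) ,
  λ i → subst₂ (λ d c → d + 1 ≤ c) (sym (degree-avoiding x-avoids i))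
          (sym (nonemptyCount-avoiding (Avoids-≤ y≤x x-avoids))) (degree< (punchIn j i))
  where
  nonempty⁺ : {S : Subset _} → Nonempty S → Nonempty (insertAt S j false)
  nonempty⁺ = Equivalence.from Nonempty-insertAt-false

U-avoiding : (x : Subset (suc m) → Bool) (j : Fin (suc m)) → ∣ U (avoiding j x) ∣ ≤ ∣ U x ∣
U-avoiding x j = subst (_≤ ∣ U x ∣) (∣insertAt-false∣ _ j) (p⊆q⇒∣p∣≤∣q∣ lifts)
  where
  lifts : insertAt (U (avoiding j x)) j false ⊆ U x
  lifts k∈ with ∈-insertAt-false⁻ k∈
  ... | i , refl , i∈U with ∈U⁻ (avoiding j x) i∈U
  ...   | S , S∈x , i∈S = ∈U⁺ x S∈x (∈-insertAt-punchIn⁺ i∈S)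

pad : (Subset m → Bool) → Subset (suc m) → Bool
pad x (false ∷ S) = x S
pad x (true ∷ S) = false

pad-avoids : (x : Subset m → Bool) → Avoids (pad x) Fin.zero
pad-avoids x (true ∷ S) here = refl

nonemptyCount-pad : (y : Subset m → Bool) → nonemptyCount (pad y) ≡ nonemptyCount y
nonemptyCount-pad y = sym (nonemptyCount-avoiding (pad-avoids y))

-- The new coordinate has degree 0, which is why a positive right-hand side of (iv) is needed.
Constraints-pad : {x y : Subset m → Bool} → Constraints m x y → 1 ≤ nonemptyCount y →
                  Constraints (suc m) (pad x) (pad y)
Constraints-pad {m} {x} {y} (mono , disjoint , y≤x , degree<) 1≤count =
  mono′ , disjoint′ , y≤x′ ,
  λ { Fin.zero → subst₂ (λ d c → d + 1 ≤ c) (sym degree-new) (sym (nonemptyCount-pad y)) 1≤count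
    ; (Fin.suc i) → subst₂ (λ d c → d + 1 ≤ c) (degree-avoiding (pad-avoids x) i)
                      (sym (nonemptyCount-pad y)) (degree< i) }
  where
  mono′ : ∀ S T → S ⊆ T → S ≢ T → ⟦ pad x T ⟧ ≤ ⟦ pad x S ⟧
  mono′ S (true ∷ T) _ _ = z≤n
  mono′ (true ∷ S) (false ∷ T) S⊆T _ with () ← S⊆T here
  mono′ (false ∷ S) (false ∷ T) S⊆T S≢T = mono S T (drop-∷-⊆ S⊆T) (S≢T ∘ cong (false ∷_))

  disjoint′ : ∀ S T → Nonempty S → Nonempty T → S ∩ T ≡ ∅ → ⟦ pad y T ⟧ + ⟦ pad y S ⟧ ≤ 1
  disjoint′ S (true ∷ T) _ _ _ = ⟦⟧+⟦⟧≤1 {false} λ ()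
  disjoint′ (true ∷ S) (false ∷ T) _ _ _ = ⟦⟧+⟦⟧≤1 {c = false} λ _ ()
  disjoint′ (false ∷ S) (false ∷ T) S≠∅ T≠∅ S∩T≡∅ =
    disjoint S T (nonempty⁻ S≠∅) (nonempty⁻ T≠∅) (cong tail S∩T≡∅)
    where
    nonempty⁻ : {S : Subset m} → Nonempty (false ∷ S) → Nonempty S
    nonempty⁻ = Equivalence.to (Nonempty-insertAt-false {j = Fin.zero})

  y≤x′ : ∀ S → ⟦ pad y S ⟧ ≤ ⟦ pad x S ⟧
  y≤x′ (false ∷ S) = y≤x S
  y≤x′ (true ∷ S) = z≤n

  degree-new : degree (pad x) Fin.zero ≡ 0
  degree-new = ΣS-zero {f = λ S → if does (Fin.zero ∈? S) then ⟦ pad x S ⟧ else 0}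
    λ { (false ∷ S) → refl ; (true ∷ S) → refl }

Feasible-pad : (k : ℕ) {x y : Subset m → Bool} → Constraints m x y → 1 ≤ nonemptyCount y →
               Feasible (k + m)
Feasible-pad zero c _ = _ , _ , c
Feasible-pad {m} (suc k) {y = y} c 1≤count = subst Feasible (+-suc k m)
  (Feasible-pad k (Constraints-pad c 1≤count) (subst (1 ≤_) (sym (nonemptyCount-pad y)) 1≤count))

∃∉ : (p : Subset m) → ∣ p ∣ < m → ∃ λ j → j ∉ p
∃∉ (false ∷ p) _ = Fin.zero , λ ()
∃∉ (true ∷ p) (s≤s ∣p∣<m) with ∃∉ p ∣p∣<m
... | j , j∉p = Fin.suc j , λ { (there j∈p) → j∉p j∈p }

Constraints⇒Feasible : {x y : Subset m → Bool} → Constraints m x y → 1 ≤ nonemptyCount y →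
                       ∣ U x ∣ ≤ n → Feasible n
Constraints⇒Feasible {zero} c 1≤count _ = subst Feasible (+-identityʳ _) (Feasible-pad _ c 1≤count)
Constraints⇒Feasible {suc m} {n} {x} c 1≤count ∣U∣≤n with suc m ≤? n
... | yes m≤n = subst Feasible (m∸n+n≡m m≤n) (Feasible-pad (n ∸ suc m) c 1≤count)
... | no m≰n with ∃∉ (U x) (<-≤-trans (s≤s ∣U∣≤n) (≰⇒> m≰n))
...   | j , j∉U = Constraints⇒Feasible (Constraints-avoiding x-avoids c)
                    (subst (1 ≤_) (sym (nonemptyCount-avoiding y-avoids)) 1≤count)
                    (≤-trans (U-avoiding x j) ∣U∣≤n)
  where
  x-avoids = ∉U⇒Avoids j∉U
  y-avoids = Avoids-≤ (proj₁ (proj₂ (proj₂ c))) x-avoids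

-- Maximum intersecting subfamilies

join : Family m → Family m → Family (suc m)
join G₀ G₁ (false ∷ S) = G₀ S
join G₀ G₁ (true ∷ S) = G₁ S

allFamilies : (m : ℕ) → List (Family m)
allFamilies zero = (λ _ → false) ∷ (λ _ → true) ∷ []
allFamilies (suc m) = cartesianProductWith join (allFamilies m) (allFamilies m)

allFamilies-complete : (H : Family m) → ∃ λ G → G ∈ᴸ allFamilies m × (∀ S → G S ≡ H S)
allFamilies-complete {zero} H with H [] in eq
... | false = _ , hereᴸ refl , λ { [] → sym eq }
... | true = _ , thereᴸ (hereᴸ refl) , λ { [] → sym eq }
allFamilies-complete {suc m} H
  with allFamilies-complete (λ S → H (false ∷ S)) | allFamilies-complete (λ S → H (true ∷ S))
... | G₀ , G₀∈ , G₀≗ | G₁ , G₁∈ , G₁≗ =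
  join G₀ G₁ , ∈-cartesianProductWith⁺ join G₀∈ G₁∈ ,
  λ { (false ∷ S) → G₀≗ S ; (true ∷ S) → G₁≗ S }

IntersectingIn : Family m → Family m → Set
IntersectingIn F G = G ⊆F F × Intersecting G

∀S? : {P : Subset m → Set} → Decidable P → Dec (∀ S → P S)
∀S? P? = map′ (λ ¬∃¬ S → decidable-stable (P? S) λ ¬PS → ¬∃¬ (S , ¬PS))
              (λ ∀P (S , ¬PS) → ¬PS (∀P S))
              (¬? (anySubset? (¬? ∘ P?)))

intersectingIn? : (F G : Family m) → Dec (IntersectingIn F G)
intersectingIn? F G =
  ∀S? (λ S → (G S ≟ᵇ true) →-dec (F S ≟ᵇ true)) ×-dec
  ∀S? (λ S → ∀S? λ T → (G S ≟ᵇ true) →-dec (G T ≟ᵇ true) →-dec nonempty? (S ∩ T))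

IntersectingIn-cong : {F G H : Family m} → (∀ S → G S ≡ H S) → IntersectingIn F H → IntersectingIn F G
IntersectingIn-cong G≗H (H⊆F , H-intersecting) =
  (λ S S∈G → H⊆F S (trans (sym (G≗H S)) S∈G)) ,
  (λ S T S∈G T∈G → H-intersecting S T (trans (sym (G≗H S)) S∈G) (trans (sym (G≗H T)) T∈G))

maxIntersecting : (F : Family m) → ∃ (MaxIntersectingIn F)
maxIntersecting {m} F = G , proj₁ G-good , proj₂ G-good , maximal
  where
  candidates = filter (intersectingIn? F) (allFamilies m)
  ∅F : Family m
  ∅F _ = false
  G = argmax card ∅F candidates
  G-good : IntersectingIn F G
  G-good = argmax-all card ((λ _ ()) , (λ _ _ ())) (all-filter (intersectingIn? F) (allFamilies m))
  maximal : ∀ H → H ⊆F F → Intersecting H → card H ≤ card G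
  maximal H H⊆F H-intersecting with allFamilies-complete H
  ... | H′ , H′∈ , H′≗H = subst (_≤ card G) (card-cong H′≗H)
    (lookup (f[xs]≤f[argmax] ∅F candidates)
      (∈-filter⁺ (intersectingIn? F) H′∈ (IntersectingIn-cong H′≗H (H⊆F , H-intersecting))))

-- Feasible points give downsets without the star property

Constraints⇒Downset : {x y : Subset m → Bool} → Constraints m x y → Downset x
Constraints⇒Downset (mono , _) A B A∈x B⊆A with ≡-dec _≟ᵇ_ B A
... | yes refl = A∈x
... | no B≢A = ⟦⟧-mono⁻ (mono B A B⊆A B≢A) A∈x

nonemptyPart-intersecting : {x y : Subset m → Bool} → Constraints m x y →
                            Intersecting (restrict nonempty? y)
nonemptyPart-intersecting {y = y} (_ , disjoint , _) S T S∈ T∈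
  with restrict⁻ nonempty? y S∈ | restrict⁻ nonempty? y T∈ | nonempty? (S ∩ T)
... | _ | _ | yes S∩T≠∅ = S∩T≠∅
... | S≠∅ , S∈y | T≠∅ , T∈y | no S∩T=∅ =
  ⊥-elim (⟦⟧+⟦⟧≤1⁻ (disjoint S T S≠∅ T≠∅ (Empty-unique S∩T=∅)) T∈y S∈y)

Star-card≤degree : {G x : Family (suc m)} → G ⊆F x → Star G → ∃ λ i → card G ≤ degree x i
Star-card≤degree _ (inj₁ none) = Fin.zero , subst (_≤ _) (sym (card-NoMembers none)) z≤n
Star-card≤degree {x = x} G⊆x (inj₂ (i , _ , common)) =
  i , ≤-trans (card-mono G⊆star) (≤-reflexive (card-restrict (i ∈?_) x))
  where
  G⊆star : _ ⊆F restrict (i ∈?_) x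
  G⊆star S S∈G = restrict⁺ (i ∈?_) x (common S S∈G) (G⊆x S S∈G)

Constraints⇒¬StarProperty : {x y : Subset (suc m) → Bool} → Constraints (suc m) x y → ¬ StarProperty x
Constraints⇒¬StarProperty {x = x} {y} c@(_ , _ , y≤x , degree<) (G , (G⊆x , _ , G-maximum) , G-star) =
  m+1+n≰m (degree x i) (begin
    degree x i + 1               ≤⟨ degree< i ⟩
    nonemptyCount y              ≡⟨ card-restrict nonempty? y ⟨
    card (restrict nonempty? y)  ≤⟨ G-maximum _ Y⊆x (nonemptyPart-intersecting c) ⟩
    card G                       ≤⟨ G≤degree ⟩
    degree x i                   ∎)
  where
  open ≤-Reasoning
  i = proj₁ (Star-card≤degree G⊆x G-star)
  G≤degree = proj₂ (Star-card≤degree G⊆x G-star)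
  Y⊆x : restrict nonempty? y ⊆F x
  Y⊆x S S∈Y = ⟦⟧-mono⁻ (y≤x S) (proj₂ (restrict⁻ nonempty? y S∈Y))

-- Downsets without the star property give feasible points

nonemptyCount-Intersecting : {G : Family m} → Intersecting G → nonemptyCount G ≡ card G
nonemptyCount-Intersecting {G = G} G-intersecting = trans
  (sym (card-restrict nonempty? G))
  (card-cong (restrict-all nonempty? G λ S S∈G →
    let k , k∈S∩S = G-intersecting S S S∈G S∈G in k , proj₁ (x∈p∩q⁻ S S k∈S∩S)))

Downset-Intersecting⇒Constraints : {F G : Family m} → Downset F → IntersectingIn F G →
                                   (∀ i → degree F i < card G) → Constraints m F G
Downset-Intersecting⇒Constraints {F = F} {G} down (G⊆F , G-intersecting) degree<card =
  (λ S T S⊆T _ → ⟦⟧-mono λ T∈F → down T S T∈F S⊆T) ,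
  (λ S T _ _ S∩T≡∅ → ⟦⟧+⟦⟧≤1 λ T∈G S∈G →
    let k , k∈S∩T = G-intersecting S T S∈G T∈G in ∉⊥ (subst (k ∈_) S∩T≡∅ k∈S∩T)) ,
  (λ S → ⟦⟧-mono (G⊆F S)) ,
  λ i → subst₂ _≤_ (+-comm 1 (degree F i)) (sym (nonemptyCount-Intersecting G-intersecting))
                   (degree<card i)

Star-common : {F : Family m} (i : Fin m) → (∀ S → S ∈F F → i ∈ S) → Star F
Star-common {F = F} i common with anySubset? (λ S → F S ≟ᵇ true)
... | yes (S , S∈F) = inj₂ (i , ∈U⁺ F S∈F (common S S∈F) , common)
... | no none = inj₁ λ S S∈F → none (S , S∈F)

StarProperty-of-degree : {F G : Family m} (i : Fin m) → MaxIntersectingIn F G → card G ≤ degree F i →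
                         StarProperty F
StarProperty-of-degree {F = F} i (_ , _ , G-maximum) G≤degree =
  star , (star⊆F , star-intersecting , star-maximum) , Star-common i i∈
  where
  star = restrict (i ∈?_) F
  i∈ : ∀ S → S ∈F star → i ∈ S
  i∈ S S∈ = proj₁ (restrict⁻ (i ∈?_) F S∈)
  star⊆F : star ⊆F F
  star⊆F S S∈ = proj₂ (restrict⁻ (i ∈?_) F S∈)
  star-intersecting : Intersecting star
  star-intersecting S T S∈ T∈ = i , x∈p∩q⁺ (i∈ S S∈ , i∈ T T∈)
  star-maximum : ∀ H → H ⊆F F → Intersecting H → card H ≤ card star
  star-maximum H H⊆F H-intersecting = ≤-trans (G-maximum H H⊆F H-intersecting)
    (≤-trans G≤degree (≤-reflexive (sym (card-restrict (i ∈?_) F))))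

Infeasible⇒StarProperty : Infeasible n → (F : Family m) → Downset F → ∣ U F ∣ ≤ n → StarProperty F
Infeasible⇒StarProperty infeasible F down ∣U∣≤n with maxIntersecting F
... | G , G-max with anySubset? (λ S → G S ≟ᵇ true)
...   | no G-empty = G , G-max , inj₁ λ S S∈G → G-empty (S , S∈G)
...   | yes (S , S∈G) with any? (λ i → card G ≤? degree F i)
...     | yes (i , G≤degree) = StarProperty-of-degree i G-max G≤degree
...     | no no-i = contradiction (Constraints⇒Feasible solution 1≤count ∣U∣≤n) infeasible
  where
  G-intersecting = proj₁ (proj₂ G-max)
  solution = Downset-Intersecting⇒Constraints down (proj₁ G-max , G-intersecting)
               λ i → ≰⇒> λ G≤ → no-i (i , G≤)
  1≤count = subst (1 ≤_) (sym (nonemptyCount-Intersecting G-intersecting)) (card-pos {F = G} S∈G)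

-- For n = 0 the claim fails ((iv) is vacuous, so I_0 is feasible); 1 ≤ n gives a
-- coordinate against which to measure the empty star in Star-card≤degree.
theorem2p1 : (n : ℕ) → 1 ≤ n → AllDownsetsStar n ⇔ Infeasible n
theorem2p1 (suc n) _ = mk⇔
  (λ all-star (x , y , c) →
    Constraints⇒¬StarProperty c (all-star _ x (Constraints⇒Downset c) (∣p∣≤n (U x))))
  (λ infeasible m F → Infeasible⇒StarProperty infeasible F)
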